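{- For each natural number $M$, as formal power series in $q$, $$\sum_{n\ge1}\frac{q^{nM+n}}{(1-q^{n})^2(1-q^{n+1})\cdots(1-q^{n+M})} =\frac{1}{(q;q)_{M}}\sum_{n\ge1}\frac{nq^n}{1-q^n}+(q;q)_{M}\sum_{n\ge1}\frac{(-1)^nq^{n(n+1)/2}(1+q^n)}{(q;q)_{M-n}(q;q)_{M+n}(1-q^n)^2}.$$
   Context: Notation: $(a;q)_n=\prod_{k=0}^{n-1}(1-aq^k)$ for $n\ge0$; for negative $k$ one uses the convention $1/(q;q)_{k}=0$, so the last sum effectively runs over $1\le n\le M$. -}

module Defs where

open import Data.Nat as ℕ using (ℕ; zero; suc; _∸_; _≤?_)
open import Data.Nat.Divisibility using (_∣?_)
open import Data.Integer as ℤ using (ℤ; +_; -_; 0ℤ; 1ℤ)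
open import Relation.Nullary using (yes; no)
open import Relation.Binary.PropositionalEquality using (_≡_)

-- Formal power series in q with integer coefficients: f N = coefficient of q^N.
PS : Set
PS = ℕ → ℤ

∑< : ℕ → (ℕ → ℤ) → ℤ
∑< zero    f = 0ℤ
∑< (suc n) f = ∑< n f ℤ.+ f n

infixl 6 _⊕_
infixl 7 _⊛_ _·_

_⊕_ : PS → PS → PS
(f ⊕ g) N = f N ℤ.+ g N

_⊛_ : PS → PS → PS
(f ⊛ g) N = ∑< (suc N) (λ i → f i ℤ.* g (N ∸ i))

_·_ : ℤ → PS → PS
(c · f) N = c ℤ.* f N

𝟙 : PS
𝟙 zero    = 1ℤ
𝟙 (suc _) = 0ℤ

𝟘 : PS
𝟘 _ = 0ℤ

q^ : ℕ → PS
q^ k N with k ℕ.≟ N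
... | yes _ = 1ℤ
... | no  _ = 0ℤ

1-q^ : ℕ → PS
1-q^ k N = 𝟙 N ℤ.- q^ k N

-- the formal power series 1/(1 - q^k) = Σ_{j≥0} q^{jk}   (used only for k ≥ 1)
1/[1-q^_] : ℕ → PS
1/[1-q^ k ] N with k ∣? N
... | yes _ = 1ℤ
... | no  _ = 0ℤ

∏₁ : ℕ → (ℕ → PS) → PS
∏₁ zero    f = 𝟙
∏₁ (suc m) f = ∏₁ m f ⊛ f (suc m)

poch : ℕ → PS
poch m = ∏₁ m 1-q^

1/poch : ℕ → PS
1/poch m = ∏₁ m 1/[1-q^_]

-- 1/(q;q)_k for an integer index k = a - b, with the convention 1/(q;q)_k = 0 for k < 0
1/poch[_-_] : ℕ → ℕ → PS
1/poch[ a - b ] with b ≤? a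
... | yes _ = 1/poch (a ∸ b)
... | no  _ = 𝟘

-- Formal infinite sum Σ_{n≥1} F n, for families where F n is divisible by q^n
-- (i.e. has no coefficients below degree n); then the coefficient of q^N only
-- receives contributions from 1 ≤ n ≤ N.
∑≥1 : (ℕ → PS) → PS
∑≥1 F N = ∑< N (λ i → F (suc i) N)

infix 4 _≐_
_≐_ : PS → PS → Set
f ≐ g = ∀ N → f N ≡ g N

{-# OPTIONS --safe #-}
-- Write X_M for the left-hand side, Z_M for the sum on the right and
-- H_M = Σ_{k=1}^{M} q^k/(1-q^k)^2.  Multiplied by 1 - q^{M+1}, the n-th term of X_M becomes
-- (1 - q^{M+1})^2 times the n-th term of X_{M+1} plus a difference that telescopes in n, whence
-- (q;q)_M X_M - (q;q)_{M+1} X_{M+1} = q^{M+1}/(1-q^{M+1})^2 and (q;q)_M X_M = X_0 - H_M.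
-- Likewise (q;q)_M^2 Z_M is a finite sum (1/(q;q)_{M-n} = 0 for n > M) whose n-th term differs
-- from that of (q;q)_{M+1}^2 Z_{M+1} by q^{M+1}/(1-q^{M+1})^2 times a difference telescoping
-- to 1, so (q;q)_M^2 Z_M = -H_M.  Finally X_0 = Σ_{n,j} j q^{jn} = Σ_n n q^n/(1-q^n) by
-- expanding geometric series, and X_M = (X_0 - H_M)/(q;q)_M is the right-hand side.
module Submission where

open import Defs
open import Data.Nat using (ℕ; _+_; _*_; suc; _/_)
open import Data.Integer using (+_; -_; 1ℤ; _^_)

open import Algebra.Bundles using (CommutativeRing)
open import Algebra.Solver.Ring.AlmostCommutativeRing
  using (fromCommutativeRing; _-Raw-AlmostCommutative⟶_)
import Algebra.Solver.Ring
open import Data.Empty using (⊥-elim)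
open import Data.Integer as ℤ using (ℤ; 0ℤ; -[1+_]) renaming (_+_ to _+ℤ_; _*_ to _*ℤ_; -_ to -ℤ_)
import Data.Integer.Properties as ℤP
import Data.Integer.Solver as ℤ-Solver
open import Algebra.Properties.CommutativeSemigroup ℤP.+-commutativeSemigroup using (interchange)
open import Data.Maybe using (Maybe; just; nothing)
open import Data.Nat as ℕ using (zero; pred; _∸_; _≤_; _<_; z≤n; s≤s; NonZero)
open import Data.Nat.DivMod using (m*n/n≡m; +-distrib-/-∣ʳ)
open import Data.Nat.Divisibility
  using (_∣_; _∣?_; _∣0; ∣⇒≤; ∣-refl; n∣m*n; ∣m+n∣m⇒∣n; ∣m∸n∣n⇒∣m)
import Data.Nat.Properties as ℕP
import Data.Nat.Solver as ℕ-Solver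
open import Data.Product using (_,_)
open import Data.Sum using (inj₁; inj₂)
open import Function using (_∘_)
open import Relation.Binary.Bundles using (Setoid)
open import Relation.Binary.PropositionalEquality
  using (_≡_; _≢_; refl; sym; trans; cong; cong₂; subst; module ≡-Reasoning; _→-setoid_)
import Relation.Binary.Reasoning.Setoid as SetoidReasoning
open import Relation.Nullary using (Dec; yes; no)

∑<-cong : ∀ n {f g : ℕ → ℤ} → (∀ i → i < n → f i ≡ g i) → ∑< n f ≡ ∑< n g
∑<-cong zero    f≡g = refl
∑<-cong (suc n) f≡g =
  cong₂ _+ℤ_ (∑<-cong n (λ i i<n → f≡g i (ℕP.m<n⇒m<1+n i<n))) (f≡g n ℕP.≤-refl)

∑<-zero : ∀ n → ∑< n (λ _ → 0ℤ) ≡ 0ℤ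
∑<-zero zero    = refl
∑<-zero (suc n) = cong (_+ℤ 0ℤ) (∑<-zero n)

∑<-≡0 : ∀ n {f : ℕ → ℤ} → (∀ i → i < n → f i ≡ 0ℤ) → ∑< n f ≡ 0ℤ
∑<-≡0 n f≡0 = trans (∑<-cong n f≡0) (∑<-zero n)

∑<-distrib-+ : ∀ n (f g : ℕ → ℤ) → ∑< n (λ i → f i +ℤ g i) ≡ ∑< n f +ℤ ∑< n g
∑<-distrib-+ zero    f g = refl
∑<-distrib-+ (suc n) f g =
  trans (cong (_+ℤ (f n +ℤ g n)) (∑<-distrib-+ n f g)) (interchange (∑< n f) (∑< n g) (f n) (g n))

∑<-*ˡ : ∀ n c (f : ℕ → ℤ) → ∑< n (λ i → c *ℤ f i) ≡ c *ℤ ∑< n f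
∑<-*ˡ zero    c f = sym (ℤP.*-zeroʳ c)
∑<-*ˡ (suc n) c f =
  trans (cong (_+ℤ c *ℤ f n) (∑<-*ˡ n c f)) (sym (ℤP.*-distribˡ-+ c (∑< n f) (f n)))

∑<-*ʳ : ∀ n c (f : ℕ → ℤ) → ∑< n (λ i → f i *ℤ c) ≡ ∑< n f *ℤ c
∑<-*ʳ n c f = trans (∑<-cong n (λ i _ → ℤP.*-comm (f i) c)) (trans (∑<-*ˡ n c f) (ℤP.*-comm c _))

∑<-head : ∀ n (f : ℕ → ℤ) → ∑< (suc n) f ≡ f 0 +ℤ ∑< n (f ∘ suc)
∑<-head zero    f = trans (ℤP.+-identityˡ (f 0)) (sym (ℤP.+-identityʳ (f 0)))
∑<-head (suc n) f = trans (cong (_+ℤ f (suc n)) (∑<-head n f)) (ℤP.+-assoc (f 0) _ _)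

∑<-reverse : ∀ n (f : ℕ → ℤ) → ∑< n f ≡ ∑< n (λ i → f (n ∸ suc i))
∑<-reverse zero    f = refl
∑<-reverse (suc n) f = begin
  ∑< n f +ℤ f n                      ≡⟨ ℤP.+-comm _ (f n) ⟩
  f n +ℤ ∑< n f                      ≡⟨ cong (f n +ℤ_) (∑<-reverse n f) ⟩
  f n +ℤ ∑< n (λ i → f (n ∸ suc i))  ≡⟨ ∑<-head n (λ i → f (n ∸ i)) ⟨
  ∑< (suc n) (λ i → f (n ∸ i))        ∎
  where open ≡-Reasoning

∑<-swap : ∀ m n (F : ℕ → ℕ → ℤ) →
  ∑< m (λ i → ∑< n (F i)) ≡ ∑< n (λ j → ∑< m (λ i → F i j))
∑<-swap zero    n F = sym (∑<-zero n)
∑<-swap (suc m) n F =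
  trans (cong (_+ℤ ∑< n (F m)) (∑<-swap m n F)) (sym (∑<-distrib-+ n _ (F m)))

∑<-triangle : ∀ n (F : ℕ → ℕ → ℤ) →
  ∑< n (λ i → ∑< (suc i) (F i)) ≡ ∑< n (λ j → ∑< (n ∸ j) (λ k → F (j + k) j))
∑<-triangle zero    F = refl
∑<-triangle (suc n) F = begin
  ∑< n (λ i → ∑< (suc i) (F i)) +ℤ ∑< (suc n) (F n)
    ≡⟨ cong (_+ℤ ∑< (suc n) (F n)) (∑<-triangle n F) ⟩
  ∑< n (λ j → ∑< (n ∸ j) (G j)) +ℤ ∑< (suc n) (F n)
    ≡⟨ cong (_+ℤ ∑< (suc n) (F n)) last-empty ⟨
  ∑< (suc n) (λ j → ∑< (n ∸ j) (G j)) +ℤ ∑< (suc n) (F n)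
    ≡⟨ ∑<-distrib-+ (suc n) _ _ ⟨
  ∑< (suc n) (λ j → ∑< (n ∸ j) (G j) +ℤ F n j)
    ≡⟨ ∑<-cong (suc n) (λ j j≤n → extend j (ℕP.≤-pred j≤n)) ⟩
  ∑< (suc n) (λ j → ∑< (suc n ∸ j) (G j)) ∎
  where
  open ≡-Reasoning
  G : ℕ → ℕ → ℤ
  G j k = F (j + k) j
  last-empty : ∑< (suc n) (λ j → ∑< (n ∸ j) (G j)) ≡ ∑< n (λ j → ∑< (n ∸ j) (G j))
  last-empty = trans (cong (λ k → ∑< n (λ j → ∑< (n ∸ j) (G j)) +ℤ ∑< k (G n)) (ℕP.n∸n≡0 n))
                     (ℤP.+-identityʳ _)
  extend : ∀ j → j ≤ n → ∑< (n ∸ j) (G j) +ℤ F n j ≡ ∑< (suc n ∸ j) (G j)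
  extend j j≤n rewrite ℕP.+-∸-assoc 1 j≤n =
    cong (λ k → ∑< (n ∸ j) (G j) +ℤ F k j) (sym (ℕP.m+[n∸m]≡n j≤n))

-- The ring of formal power series

neg : PS → PS
neg f N = -ℤ f N

-- The Cauchy product, made opaque so that checking ring-solver equations never unfolds it into
-- coefficient sums.
opaque
  infixl 7 _⊙_
  _⊙_ : PS → PS → PS
  _⊙_ = _⊛_

opaque
  unfolding _⊙_

  ⊛≐⊙ : ∀ f g → f ⊛ g ≐ f ⊙ g
  ⊛≐⊙ f g N = refl

  ⊙-cong : ∀ {f f′ g g′} → f ≐ f′ → g ≐ g′ → f ⊙ g ≐ f′ ⊙ g′
  ⊙-cong f≐f′ g≐g′ N = ∑<-cong (suc N) (λ i _ → cong₂ _*ℤ_ (f≐f′ i) (g≐g′ (N ∸ i)))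

  ⊙-comm : ∀ f g → f ⊙ g ≐ g ⊙ f
  ⊙-comm f g N = begin
    ∑< (suc N) (λ i → f i *ℤ g (N ∸ i))              ≡⟨ ∑<-reverse (suc N) _ ⟩
    ∑< (suc N) (λ i → f (N ∸ i) *ℤ g (N ∸ (N ∸ i)))  ≡⟨ ∑<-cong (suc N) swap ⟩
    ∑< (suc N) (λ i → g i *ℤ f (N ∸ i))              ∎
    where
    open ≡-Reasoning
    swap : ∀ i → i < suc N → f (N ∸ i) *ℤ g (N ∸ (N ∸ i)) ≡ g i *ℤ f (N ∸ i)
    swap i i<1+N = trans (cong (λ k → f (N ∸ i) *ℤ g k) (ℕP.m∸[m∸n]≡n (ℕP.≤-pred i<1+N)))
                         (ℤP.*-comm (f (N ∸ i)) (g i))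

  ⊙-identityˡ : ∀ f → 𝟙 ⊙ f ≐ f
  ⊙-identityˡ f N = begin
    ∑< (suc N) (λ i → 𝟙 i *ℤ f (N ∸ i))             ≡⟨ ∑<-head N _ ⟩
    1ℤ *ℤ f N +ℤ ∑< N (λ i → 0ℤ *ℤ f (N ∸ suc i))   ≡⟨ cong₂ _+ℤ_ (ℤP.*-identityˡ (f N)) (∑<-zero N) ⟩
    f N +ℤ 0ℤ                                        ≡⟨ ℤP.+-identityʳ (f N) ⟩
    f N                                              ∎
    where open ≡-Reasoning

  ⊙-distribˡ-⊕ : ∀ f g h → f ⊙ (g ⊕ h) ≐ f ⊙ g ⊕ f ⊙ h
  ⊙-distribˡ-⊕ f g h N =
    trans (∑<-cong (suc N) (λ i _ → ℤP.*-distribˡ-+ (f i) (g (N ∸ i)) (h (N ∸ i))))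
          (∑<-distrib-+ (suc N) _ _)

  ⊙-assoc : ∀ f g h → (f ⊙ g) ⊙ h ≐ f ⊙ (g ⊙ h)
  ⊙-assoc f g h N = begin
    ∑< (suc N) (λ i → ∑< (suc i) (λ j → f j *ℤ g (i ∸ j)) *ℤ h (N ∸ i))
      ≡⟨ ∑<-cong (suc N) (λ i _ → sym (∑<-*ʳ (suc i) (h (N ∸ i)) _)) ⟩
    ∑< (suc N) (λ i → ∑< (suc i) (λ j → f j *ℤ g (i ∸ j) *ℤ h (N ∸ i)))
      ≡⟨ ∑<-triangle (suc N) (λ i j → f j *ℤ g (i ∸ j) *ℤ h (N ∸ i)) ⟩
    ∑< (suc N) (λ j → ∑< (suc N ∸ j) (λ k → f j *ℤ g (j + k ∸ j) *ℤ h (N ∸ (j + k))))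
      ≡⟨ ∑<-cong (suc N) (λ j j<1+N → inner j (ℕP.≤-pred j<1+N)) ⟩
    ∑< (suc N) (λ j → f j *ℤ ∑< (suc (N ∸ j)) (λ k → g k *ℤ h (N ∸ j ∸ k))) ∎
    where
    open ≡-Reasoning
    inner : ∀ j → j ≤ N → ∑< (suc N ∸ j) (λ k → f j *ℤ g (j + k ∸ j) *ℤ h (N ∸ (j + k)))
                          ≡ f j *ℤ ∑< (suc (N ∸ j)) (λ k → g k *ℤ h (N ∸ j ∸ k))
    inner j j≤N rewrite ℕP.+-∸-assoc 1 j≤N =
      trans (∑<-cong (suc (N ∸ j)) (λ k _ →
               trans (cong₂ (λ a b → f j *ℤ g a *ℤ h b)
                            (ℕP.m+n∸m≡n j k) (sym (ℕP.∸-+-assoc N j k)))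
                     (ℤP.*-assoc (f j) (g k) (h (N ∸ j ∸ k)))))
            (∑<-*ˡ (suc (N ∸ j)) (f j) _)

  ·-⊙ : ∀ c f g → (c · f) ⊙ g ≐ c · (f ⊙ g)
  ·-⊙ c f g N =
    trans (∑<-cong (suc N) (λ i _ → ℤP.*-assoc c (f i) (g (N ∸ i)))) (∑<-*ˡ (suc N) c _)

≐-setoid : Setoid _ _
≐-setoid = ℕ →-setoid ℤ

open Setoid ≐-setoid using () renaming (refl to ≐-refl; sym to ≐-sym; trans to ≐-trans)

PS-commutativeRing : CommutativeRing _ _
PS-commutativeRing = record
  { Carrier = PS ; _≈_ = _≐_ ; _+_ = _⊕_ ; _*_ = _⊙_ ; -_ = neg ; 0# = 𝟘 ; 1# = 𝟙
  ; isCommutativeRing = record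
    { isRing = record
      { +-isAbelianGroup = record
        { isGroup = record
          { isMonoid = record
            { isSemigroup = record
              { isMagma = record
                { isEquivalence = Setoid.isEquivalence ≐-setoid
                ; ∙-cong = λ f≐f′ g≐g′ N → cong₂ _+ℤ_ (f≐f′ N) (g≐g′ N) }
              ; assoc = λ f g h N → ℤP.+-assoc (f N) (g N) (h N) }
            ; identity = (λ f N → ℤP.+-identityˡ (f N)) , (λ f N → ℤP.+-identityʳ (f N)) }
          ; inverse = (λ f N → ℤP.+-inverseˡ (f N)) , (λ f N → ℤP.+-inverseʳ (f N))
          ; ⁻¹-cong = λ f≐g N → cong -ℤ_ (f≐g N) }
        ; comm = λ f g N → ℤP.+-comm (f N) (g N) }
      ; *-cong = ⊙-cong
      ; *-assoc = ⊙-assoc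
      ; *-identity = ⊙-identityˡ , (λ f → ≐-trans (⊙-comm f 𝟙) (⊙-identityˡ f))
      ; distrib = ⊙-distribˡ-⊕ , λ f g h → ≐-trans (⊙-comm (g ⊕ h) f)
                    (≐-trans (⊙-distribˡ-⊕ f g h) (λ N → cong₂ _+ℤ_ (⊙-comm f g N) (⊙-comm f h N)))
      }
    ; *-comm = ⊙-comm
    }
  }

open CommutativeRing PS-commutativeRing
  using () renaming (+-cong to ⊕-cong; +-congˡ to ⊕-congˡ; +-congʳ to ⊕-congʳ;
                     *-congˡ to ⊙-congˡ; *-congʳ to ⊙-congʳ; -‿cong to neg-cong;
                     zeroˡ to ⊙-zeroˡ; zeroʳ to ⊙-zeroʳ; *-identityʳ to ⊙-identityʳ;
                     +-identityˡ to ⊕-identityˡ; +-identityʳ to ⊕-identityʳ)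

open import Algebra.Properties.Group (CommutativeRing.+-group PS-commutativeRing) using (x∙y⁻¹≈ε⇒x≈y)

module ≐-Reasoning = SetoidReasoning ≐-setoid

·-cong : ∀ c {f g} → f ≐ g → c · f ≐ c · g
·-cong c f≐g N = cong (c *ℤ_) (f≐g N)

-- The literals 0 and 1 compute to 𝟘 and 𝟙, so the constants of the ring solver are the series
-- written in statements.
const : ℤ → PS
const (+ 0) = 𝟘
const (+ 1) = 𝟙
const c     = c · 𝟙

const≐· : ∀ c → const c ≐ c · 𝟙
const≐· (+ 0)           N = refl
const≐· (+ 1)           N = sym (ℤP.*-identityˡ (𝟙 N))
const≐· (+ suc (suc n)) N = refl
const≐· -[1+ n ]        N = refl

·≐const⊙ : ∀ c f → c · f ≐ const c ⊙ f
·≐const⊙ c f = begin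
  c · f        ≈⟨ (λ N → cong (c *ℤ_) (⊙-identityˡ f N)) ⟨
  c · (𝟙 ⊙ f)  ≈⟨ ·-⊙ c 𝟙 f ⟨
  c · 𝟙 ⊙ f    ≈⟨ ⊙-congʳ (const≐· c) ⟨
  const c ⊙ f  ∎
  where open ≐-Reasoning

const-morphism : CommutativeRing.rawRing ℤP.+-*-commutativeRing
                   -Raw-AlmostCommutative⟶ fromCommutativeRing PS-commutativeRing
const-morphism = record
  { ⟦_⟧    = const
  ; +-homo = λ a b N → begin
      const (a +ℤ b) N               ≡⟨ const≐· (a +ℤ b) N ⟩
      (a +ℤ b) *ℤ 𝟙 N                ≡⟨ ℤP.*-distribʳ-+ (𝟙 N) a b ⟩
      a *ℤ 𝟙 N +ℤ b *ℤ 𝟙 N           ≡⟨ cong₂ _+ℤ_ (const≐· a N) (const≐· b N) ⟨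
      const a N +ℤ const b N         ∎
  ; *-homo = λ a b → ≐-trans (const≐· (a *ℤ b)) (≐-trans (λ N → ℤP.*-assoc a b (𝟙 N))
                       (≐-trans (λ N → cong (a *ℤ_) (sym (const≐· b N))) (·≐const⊙ a (const b))))
  ; -‿homo = λ a N → trans (const≐· (-ℤ a) N)
                       (trans (sym (ℤP.neg-distribˡ-* a (𝟙 N))) (cong -ℤ_ (sym (const≐· a N))))
  ; 0-homo = ≐-refl
  ; 1-homo = ≐-refl
  }
  where open ≡-Reasoning

const-≟ : ∀ a b → Maybe (const a ≐ const b)
const-≟ a b with a ℤ.≟ b
... | yes refl = just ≐-refl
... | no  _    = nothing

module PS-Solver = Algebra.Solver.Ring
  (CommutativeRing.rawRing ℤP.+-*-commutativeRing) (fromCommutativeRing PS-commutativeRing)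
  const-morphism const-≟

open PS-Solver using (solve; _:=_; _:+_; _:*_; _:-_; :-_; con)

u⊙f≐g⇒f≐i⊙g : ∀ {u i f g} → u ⊙ i ≐ 𝟙 → u ⊙ f ≐ g → f ≐ i ⊙ g
u⊙f≐g⇒f≐i⊙g {u} {i} {f} {g} ui≐𝟙 uf≐g = begin
  f            ≈⟨ ⊙-identityˡ f ⟨
  𝟙 ⊙ f        ≈⟨ ⊙-congʳ ui≐𝟙 ⟨
  u ⊙ i ⊙ f    ≈⟨ solve 3 (λ u i f → u :* i :* f := i :* (u :* f)) ≐-refl u i f ⟩
  i ⊙ (u ⊙ f)  ≈⟨ ⊙-congˡ uf≐g ⟩
  i ⊙ g        ∎
  where open ≐-Reasoning

u⊙f≐u⊙g⇒f≐g : ∀ {u i f g} → u ⊙ i ≐ 𝟙 → u ⊙ f ≐ u ⊙ g → f ≐ g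
u⊙f≐u⊙g⇒f≐g {u} {i} {f} {g} ui≐𝟙 uf≐ug = ≐-trans (u⊙f≐g⇒f≐i⊙g ui≐𝟙 uf≐ug) (begin
  i ⊙ (u ⊙ g)  ≈⟨ solve 3 (λ u i g → i :* (u :* g) := u :* i :* g) ≐-refl u i g ⟩
  u ⊙ i ⊙ g    ≈⟨ ⊙-congʳ ui≐𝟙 ⟩
  𝟙 ⊙ g        ≈⟨ ⊙-identityˡ g ⟩
  g            ∎)
  where open ≐-Reasoning

-- An identity L ≐ R involving inverses i, j of units u, v is certified by the ring solver
-- checking L - R = A (u i - 1) + B (v j - 1).
≐-by-unit : ∀ {L R A U} → U ≐ 𝟙 → L ⊕ neg R ≐ A ⊙ (U ⊕ neg 𝟙) → L ≐ R
≐-by-unit {L} {R} {A} {U} U≐𝟙 L-R≐ = x∙y⁻¹≈ε⇒x≈y L R (begin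
  L ⊕ neg R          ≈⟨ L-R≐ ⟩
  A ⊙ (U ⊕ neg 𝟙)    ≈⟨ ⊙-congˡ (⊕-congʳ {neg 𝟙} U≐𝟙) ⟩
  A ⊙ (𝟙 ⊕ neg 𝟙)    ≈⟨ solve 1 (λ A → A :* (con 1ℤ :- con 1ℤ) := con 0ℤ) ≐-refl A ⟩
  𝟘                  ∎)
  where open ≐-Reasoning

≐-by-units : ∀ {L R A B U V} → U ≐ 𝟙 → V ≐ 𝟙 →
  L ⊕ neg R ≐ A ⊙ (U ⊕ neg 𝟙) ⊕ B ⊙ (V ⊕ neg 𝟙) → L ≐ R
≐-by-units {L} {R} {A} {B} {U} {V} U≐𝟙 V≐𝟙 L-R≐ = x∙y⁻¹≈ε⇒x≈y L R (begin
  L ⊕ neg R                            ≈⟨ L-R≐ ⟩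
  A ⊙ (U ⊕ neg 𝟙) ⊕ B ⊙ (V ⊕ neg 𝟙)
    ≈⟨ ⊕-cong (⊙-congˡ (⊕-congʳ {neg 𝟙} U≐𝟙)) (⊙-congˡ (⊕-congʳ {neg 𝟙} V≐𝟙)) ⟩
  A ⊙ (𝟙 ⊕ neg 𝟙) ⊕ B ⊙ (𝟙 ⊕ neg 𝟙)
    ≈⟨ solve 2 (λ A B → A :* (con 1ℤ :- con 1ℤ) :+ B :* (con 1ℤ :- con 1ℤ) := con 0ℤ) ≐-refl A B ⟩
  𝟘 ∎)
  where open ≐-Reasoning

q^-same : ∀ k → q^ k k ≡ 1ℤ
q^-same k with k ℕ.≟ k
... | yes _   = refl
... | no k≢k  = ⊥-elim (k≢k refl)

q^-diff : ∀ {k N} → k ≢ N → q^ k N ≡ 0ℤ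
q^-diff {k} {N} k≢N with k ℕ.≟ N
... | yes k≡N = ⊥-elim (k≢N k≡N)
... | no  _   = refl

q^-cong : ∀ {a b} → a ≡ b → q^ a ≐ q^ b
q^-cong a≡b N = cong (λ k → q^ k N) a≡b

q^-zero : q^ 0 ≐ 𝟙
q^-zero zero    = refl
q^-zero (suc N) = refl

∑<-q^-≤ : ∀ n k (g : ℕ → ℤ) → n ≤ k → ∑< n (λ i → q^ k i *ℤ g i) ≡ 0ℤ
∑<-q^-≤ n k g n≤k =
  ∑<-≡0 n (λ i i<n → cong (_*ℤ g i) (q^-diff (λ k≡i → ℕP.<⇒≱ i<n (subst (n ≤_) k≡i n≤k))))

∑<-q^-> : ∀ n k (g : ℕ → ℤ) → k < n → ∑< n (λ i → q^ k i *ℤ g i) ≡ g k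
∑<-q^-> (suc n) k g k<1+n with ℕP.m≤n⇒m<n∨m≡n (ℕP.≤-pred k<1+n)
... | inj₁ k<n  = trans (cong₂ _+ℤ_ (∑<-q^-> n k g k<n) (cong (_*ℤ g n) (q^-diff (ℕP.<⇒≢ k<n))))
                        (ℤP.+-identityʳ (g k))
... | inj₂ refl = trans (cong₂ _+ℤ_ (∑<-q^-≤ k k g ℕP.≤-refl) (cong (_*ℤ g k) (q^-same k)))
                        (trans (ℤP.+-identityˡ _) (ℤP.*-identityˡ (g k)))

opaque
  unfolding _⊙_

  q^-⊙-coeff-≤ : ∀ k f {N} → k ≤ N → (q^ k ⊙ f) N ≡ f (N ∸ k)
  q^-⊙-coeff-≤ k f {N} k≤N = ∑<-q^-> (suc N) k (λ i → f (N ∸ i)) (s≤s k≤N)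

  q^-⊙-coeff-> : ∀ k f {N} → N < k → (q^ k ⊙ f) N ≡ 0ℤ
  q^-⊙-coeff-> k f {N} N<k = ∑<-q^-≤ (suc N) k (λ i → f (N ∸ i)) N<k

q^-+ : ∀ a b → q^ a ⊙ q^ b ≐ q^ (a + b)
q^-+ a b N with a ℕ.≤? N
... | no a≰N  = trans (q^-⊙-coeff-> a (q^ b) (ℕP.≰⇒> a≰N))
                      (sym (q^-diff (λ a+b≡N → a≰N (subst (a ≤_) a+b≡N (ℕP.m≤m+n a b)))))
... | yes a≤N = trans (q^-⊙-coeff-≤ a (q^ b) a≤N) (shifted (b ℕ.≟ N ∸ a))
  where
  shifted : Dec (b ≡ N ∸ a) → q^ b (N ∸ a) ≡ q^ (a + b) N
  shifted (yes refl) =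
    trans (q^-same (N ∸ a)) (sym (subst (λ k → q^ (a + (N ∸ a)) k ≡ 1ℤ) (ℕP.m+[n∸m]≡n a≤N) (q^-same _)))
  shifted (no b≢N∸a) = trans (q^-diff b≢N∸a)
    (sym (q^-diff (λ a+b≡N → b≢N∸a (trans (sym (ℕP.m+n∸m≡n a b)) (cong (_∸ a) a+b≡N)))))

q^-split : ∀ {n N} → n ≤ N → q^ N ≐ q^ n ⊙ q^ (N ∸ n)
q^-split {n} {N} n≤N = ≐-sym (≐-trans (q^-+ n (N ∸ n)) (q^-cong (ℕP.m+[n∸m]≡n n≤N)))

1/[1-q^]-periodic : ∀ k N → k ≤ N → 1/[1-q^ k ] N ≡ 1/[1-q^ k ] (N ∸ k)
1/[1-q^]-periodic k N k≤N with k ∣? N | k ∣? (N ∸ k)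
... | yes _   | yes _    = refl
... | no  _   | no  _    = refl
... | yes k∣N | no  k∤N∸k =
  ⊥-elim (k∤N∸k (∣m+n∣m⇒∣n (subst (k ∣_) (sym (ℕP.m+[n∸m]≡n k≤N)) k∣N) ∣-refl))
... | no  k∤N | yes k∣N∸k = ⊥-elim (k∤N (∣m∸n∣n⇒∣m k k≤N k∣N∸k ∣-refl))

1/[1-q^]-below : ∀ k N → N < k → 1/[1-q^ k ] N ≡ 𝟙 N
1/[1-q^]-below k zero    _     with k ∣? 0
... | yes _   = refl
... | no  k∤0 = ⊥-elim (k∤0 (k ∣0))
1/[1-q^]-below k (suc N) 1+N<k with k ∣? suc N
... | yes k∣1+N = ⊥-elim (ℕP.<⇒≱ 1+N<k (∣⇒≤ k∣1+N))
... | no  _     = refl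

1-q^-inverse : ∀ k .{{_ : NonZero k}} → 1-q^ k ⊙ 1/[1-q^ k ] ≐ 𝟙
1-q^-inverse k = ≐-trans (solve 2 (λ x i → (con 1ℤ :- x) :* i := i :- x :* i) ≐-refl (q^ k) I) coeffwise
  where
  I = 1/[1-q^ k ]
  coeffwise : I ⊕ neg (q^ k ⊙ I) ≐ 𝟙
  coeffwise N with k ℕ.≤? N
  ... | yes k≤N =
    trans (cong₂ (λ a b → a +ℤ -ℤ b) (1/[1-q^]-periodic k N k≤N) (q^-⊙-coeff-≤ k I k≤N))
          (trans (ℤP.+-inverseʳ (I (N ∸ k))) (sym (𝟙-pos (ℕP.<-≤-trans (ℕ.>-nonZero⁻¹ k) k≤N))))
    where
    𝟙-pos : ∀ {N} → 0 < N → 𝟙 N ≡ 0ℤ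
    𝟙-pos {suc _} _ = refl
  ... | no  k≰N =
    trans (cong₂ (λ a b → a +ℤ -ℤ b) (1/[1-q^]-below k N (ℕP.≰⇒> k≰N)) (q^-⊙-coeff-> k I (ℕP.≰⇒> k≰N)))
          (ℤP.+-identityʳ (𝟙 N))

1-q^-zero : 1-q^ 0 ≐ 𝟘
1-q^-zero N = trans (cong (λ a → 𝟙 N +ℤ -ℤ a) (q^-zero N)) (ℤP.+-inverseʳ (𝟙 N))

VanishesBelow : ℕ → PS → Set
VanishesBelow k f = ∀ N → N < k → f N ≡ 0ℤ

Summable : (ℕ → PS) → Set
Summable F = ∀ n → VanishesBelow n (F n)

q^-vanishesBelow : ∀ k → VanishesBelow k (q^ k)
q^-vanishesBelow k N N<k = q^-diff (λ k≡N → ℕP.<-irrefl (sym k≡N) N<k)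

vanishesBelow-mono : ∀ {j k f} → j ≤ k → VanishesBelow k f → VanishesBelow j f
vanishesBelow-mono j≤k f≈0 N N<j = f≈0 N (ℕP.<-≤-trans N<j j≤k)

opaque
  unfolding _⊙_

  ⊙-vanishesBelowˡ : ∀ {k f} g → VanishesBelow k f → VanishesBelow k (f ⊙ g)
  ⊙-vanishesBelowˡ g f≈0 N N<k =
    ∑<-≡0 (suc N) (λ i i≤N → cong (_*ℤ g (N ∸ i)) (f≈0 i (ℕP.≤-<-trans (ℕP.≤-pred i≤N) N<k)))

⊙-vanishesBelowʳ : ∀ {k g} f → VanishesBelow k g → VanishesBelow k (f ⊙ g)
⊙-vanishesBelowʳ {g = g} f g≈0 N N<k = trans (⊙-comm f g N) (⊙-vanishesBelowˡ f g≈0 N N<k)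

·-vanishesBelow : ∀ {k f} c → VanishesBelow k f → VanishesBelow k (c · f)
·-vanishesBelow c f≈0 N N<k = trans (cong (c *ℤ_) (f≈0 N N<k)) (ℤP.*-zeroʳ c)

∑≥1-cong : ∀ {F G} → (∀ n .{{_ : NonZero n}} → F n ≐ G n) → ∑≥1 F ≐ ∑≥1 G
∑≥1-cong F≐G N = ∑<-cong N (λ i _ → F≐G (suc i) N)

∑≥1-distrib-⊕ : ∀ F G → ∑≥1 (λ n → F n ⊕ G n) ≐ ∑≥1 F ⊕ ∑≥1 G
∑≥1-distrib-⊕ F G N = ∑<-distrib-+ N _ _

∑≥1-swap : ∀ (F : ℕ → ℕ → PS) →
  ∑≥1 (λ m → ∑≥1 (λ n → F m n)) ≐ ∑≥1 (λ n → ∑≥1 (λ m → F m n))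
∑≥1-swap F N = ∑<-swap N N (λ i j → F (suc i) (suc j) N)

∑≥1-· : ∀ c F → ∑≥1 (λ n → c · F n) ≐ c · ∑≥1 F
∑≥1-· c F N = ∑<-*ˡ N c _

∑≥1-extend : ∀ {F} → Summable F → ∀ {N} K → N ≤ K → ∑≥1 F N ≡ ∑< K (λ i → F (suc i) N)
∑≥1-extend {F} summable {N} K N≤K =
  trans (extend-by (K ∸ N)) (cong (λ k → ∑< k (λ i → F (suc i) N)) (ℕP.m∸n+n≡m N≤K))
  where
  extend-by : ∀ d → ∑≥1 F N ≡ ∑< (d + N) (λ i → F (suc i) N)
  extend-by zero    = refl
  extend-by (suc d) = trans (extend-by d) (sym (trans
    (cong (∑< (d + N) (λ i → F (suc i) N) +ℤ_) (summable (suc (d + N)) N (s≤s (ℕP.m≤n+m N d))))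
    (ℤP.+-identityʳ _)))

opaque
  unfolding _⊙_

  ∑≥1-⊙ˡ : ∀ A {F} → Summable F → A ⊙ ∑≥1 F ≐ ∑≥1 (λ n → A ⊙ F n)
  ∑≥1-⊙ˡ A {F} summable N = begin
    ∑< (suc N) (λ i → A i *ℤ ∑≥1 F (N ∸ i))
      ≡⟨ ∑<-cong (suc N) (λ i _ → cong (A i *ℤ_) (∑≥1-extend summable N (ℕP.m∸n≤m N i))) ⟩
    ∑< (suc N) (λ i → A i *ℤ ∑< N (λ j → F (suc j) (N ∸ i)))
      ≡⟨ ∑<-cong (suc N) (λ i _ → sym (∑<-*ˡ N (A i) _)) ⟩
    ∑< (suc N) (λ i → ∑< N (λ j → A i *ℤ F (suc j) (N ∸ i)))
      ≡⟨ ∑<-swap (suc N) N _ ⟩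
    ∑< N (λ j → ∑< (suc N) (λ i → A i *ℤ F (suc j) (N ∸ i)))
      ∎
    where open ≡-Reasoning

∑≥1-telescope : ∀ {g} → Summable g → ∑≥1 (λ n → g n ⊕ neg (g (suc n))) ≐ g 1
∑≥1-telescope {g} summable N =
  trans (partial N) (trans (cong (λ a → g 1 N +ℤ -ℤ a) (summable (suc N) N ℕP.≤-refl)) (ℤP.+-identityʳ _))
  where
  open ℤ-Solver.+-*-Solver using () renaming (solve to ℤ-solve; _:=_ to _:=ℤ_; _:+_ to _:+ℤ_; :-_ to :-ℤ_)
  partial : ∀ m → ∑< m (λ i → g (suc i) N +ℤ -ℤ g (suc (suc i)) N) ≡ g 1 N +ℤ -ℤ g (suc m) N
  partial zero    = sym (ℤP.+-inverseʳ (g 1 N))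
  partial (suc m) = trans (cong (_+ℤ (g (suc m) N +ℤ -ℤ g (suc (suc m)) N)) (partial m))
    (ℤ-solve 3 (λ a b c → (a :+ℤ :-ℤ b) :+ℤ (b :+ℤ :-ℤ c) :=ℤ a :+ℤ :-ℤ c) refl
               (g 1 N) (g (suc m) N) (g (suc (suc m)) N))

∑≤ : ℕ → (ℕ → PS) → PS
∑≤ m F N = ∑< m (λ i → F (suc i) N)

∑≤-cong : ∀ m {F G} → (∀ n .{{_ : NonZero n}} → n ≤ m → F n ≐ G n) → ∑≤ m F ≐ ∑≤ m G
∑≤-cong m F≐G N = ∑<-cong m (λ i i<m → F≐G (suc i) i<m N)

∑≤-distrib-⊕ : ∀ m F G → ∑≤ m (λ n → F n ⊕ G n) ≐ ∑≤ m F ⊕ ∑≤ m G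
∑≤-distrib-⊕ m F G N = ∑<-distrib-+ m _ _

∑≤-⊙ˡ : ∀ A m F → A ⊙ ∑≤ m F ≐ ∑≤ m (λ n → A ⊙ F n)
∑≤-⊙ˡ A zero    F = ⊙-zeroʳ A
∑≤-⊙ˡ A (suc m) F = ≐-trans (⊙-distribˡ-⊕ A (∑≤ m F) (F (suc m))) (⊕-congʳ (∑≤-⊙ˡ A m F))

∑≤-telescope : ∀ (f c : ℕ → PS) → (∀ m → f m ≐ f (suc m) ⊕ c (suc m)) →
  ∀ m → f 0 ≐ f m ⊕ ∑≤ m c
∑≤-telescope f c step zero    = ≐-sym (⊕-identityʳ (f 0))
∑≤-telescope f c step (suc m) = begin
  f 0                              ≈⟨ ∑≤-telescope f c step m ⟩
  f m ⊕ ∑≤ m c                     ≈⟨ ⊕-congʳ (step m) ⟩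
  f (suc m) ⊕ c (suc m) ⊕ ∑≤ m c   ≈⟨ solve 3 (λ a b s → a :+ b :+ s := a :+ (s :+ b))
                                               ≐-refl (f (suc m)) (c (suc m)) (∑≤ m c) ⟩
  f (suc m) ⊕ ∑≤ (suc m) c         ∎
  where open ≐-Reasoning

∑≥1-truncate : ∀ {F} m → Summable F → (∀ n → m < n → F n ≐ 𝟘) → ∑≥1 F ≐ ∑≤ m F
∑≥1-truncate {F} m summable F≐𝟘 N =
  trans (∑≥1-extend summable (N + m) (ℕP.m≤m+n N m)) (drop N)
  where
  drop : ∀ d → ∑< (d + m) (λ i → F (suc i) N) ≡ ∑< m (λ i → F (suc i) N)
  drop zero    = refl
  drop (suc d) =
    trans (cong₂ _+ℤ_ (drop d) (F≐𝟘 (suc (d + m)) (s≤s (ℕP.m≤n+m m d)) N)) (ℤP.+-identityʳ _)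

∏₁-suc : ∀ m f → ∏₁ (suc m) f ≐ ∏₁ m f ⊙ f (suc m)
∏₁-suc m f = ⊛≐⊙ (∏₁ m f) (f (suc m))

∏₁-head : ∀ m f → ∏₁ (suc m) f ≐ f 1 ⊙ ∏₁ m (f ∘ suc)
∏₁-head zero    f = ≐-trans (∏₁-suc 0 f) (⊙-comm 𝟙 (f 1))
∏₁-head (suc m) f = begin
  ∏₁ (suc (suc m)) f                 ≈⟨ ∏₁-suc (suc m) f ⟩
  ∏₁ (suc m) f ⊙ f (2 + m)           ≈⟨ ⊙-congʳ (∏₁-head m f) ⟩
  f 1 ⊙ ∏₁ m (f ∘ suc) ⊙ f (2 + m)   ≈⟨ ⊙-assoc (f 1) _ _ ⟩
  f 1 ⊙ (∏₁ m (f ∘ suc) ⊙ f (2 + m)) ≈⟨ ⊙-congˡ (∏₁-suc m (f ∘ suc)) ⟨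
  f 1 ⊙ ∏₁ (suc m) (f ∘ suc)         ∎
  where open ≐-Reasoning

∏₁-cong : ∀ m {f g} → (∀ j .{{_ : NonZero j}} → f j ≐ g j) → ∏₁ m f ≐ ∏₁ m g
∏₁-cong zero    f≐g = ≐-refl
∏₁-cong (suc m) {f} {g} f≐g =
  ≐-trans (∏₁-suc m f) (≐-trans (⊙-cong (∏₁-cong m f≐g) (f≐g (suc m))) (≐-sym (∏₁-suc m g)))

poch-inverse : ∀ m → poch m ⊙ 1/poch m ≐ 𝟙
poch-inverse zero    = ⊙-identityˡ 𝟙
poch-inverse (suc m) = begin
  poch (suc m) ⊙ 1/poch (suc m)   ≈⟨ ⊙-cong (∏₁-suc m 1-q^) (∏₁-suc m 1/[1-q^_]) ⟩
  poch m ⊙ e ⊙ (1/poch m ⊙ i)     ≈⟨ solve 4 (λ P e I i → P :* e :* (I :* i) := P :* I :* (e :* i))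
                                             ≐-refl (poch m) e (1/poch m) i ⟩
  poch m ⊙ 1/poch m ⊙ (e ⊙ i)     ≈⟨ ⊙-cong (poch-inverse m) (1-q^-inverse (suc m)) ⟩
  𝟙 ⊙ 𝟙                           ≈⟨ ⊙-identityˡ 𝟙 ⟩
  𝟙                               ∎
  where
  open ≐-Reasoning
  e = 1-q^ (suc m)
  i = 1/[1-q^ suc m ]

1/poch-pred : ∀ m → 1/poch m ≐ 1-q^ (suc m) ⊙ 1/poch (suc m)
1/poch-pred m = begin
  1/poch m                            ≈⟨ ⊙-identityʳ (1/poch m) ⟨
  1/poch m ⊙ 𝟙                        ≈⟨ ⊙-congˡ (1-q^-inverse (suc m)) ⟨
  1/poch m ⊙ (e ⊙ i)                  ≈⟨ solve 3 (λ I e i → I :* (e :* i) := e :* (I :* i))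
                                                 ≐-refl (1/poch m) e i ⟩
  e ⊙ (1/poch m ⊙ i)                  ≈⟨ ⊙-congˡ (∏₁-suc m 1/[1-q^_]) ⟨
  e ⊙ 1/poch (suc m)                  ∎
  where
  open ≐-Reasoning
  e = 1-q^ (suc m)
  i = 1/[1-q^ suc m ]

1/poch[-]-≤ : ∀ {m n} → n ≤ m → 1/poch[ m - n ] ≐ 1/poch (m ∸ n)
1/poch[-]-≤ {m} {n} n≤m with n ℕ.≤? m
... | yes _   = ≐-refl
... | no  n≰m = ⊥-elim (n≰m n≤m)

1/poch[-]-> : ∀ {m n} → m < n → 1/poch[ m - n ] ≐ 𝟘
1/poch[-]-> {m} {n} m<n with n ℕ.≤? m
... | yes n≤m = ⊥-elim (ℕP.<⇒≱ m<n n≤m)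
... | no  _   = ≐-refl

1/poch[-]-suc : ∀ m n → 1/poch[ suc m - suc n ] ≐ 1/poch[ m - n ]
1/poch[-]-suc m n = by-cases (n ℕ.≤? m)
  where
  by-cases : Dec (n ≤ m) → 1/poch[ suc m - suc n ] ≐ 1/poch[ m - n ]
  by-cases (yes n≤m) = ≐-trans (1/poch[-]-≤ (s≤s n≤m)) (≐-sym (1/poch[-]-≤ n≤m))
  by-cases (no  n≰m) =
    ≐-trans (1/poch[-]-> (s≤s (ℕP.≰⇒> n≰m))) (≐-sym (1/poch[-]-> (ℕP.≰⇒> n≰m)))

-- For n = m + 1 both sides vanish: the left by the convention 1/(q;q)₋₁ = 0, the right as 1 - q⁰ = 0.
1/poch[-]-pred : ∀ m n → n ≤ suc m → 1/poch[ m - n ] ≐ 1-q^ (suc m ∸ n) ⊙ 1/poch[ suc m - n ]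
1/poch[-]-pred m n n≤1+m with ℕP.m≤n⇒m<n∨m≡n n≤1+m
... | inj₁ n<1+m = begin
  1/poch[ m - n ]                              ≈⟨ 1/poch[-]-≤ n≤m ⟩
  1/poch (m ∸ n)                               ≈⟨ 1/poch-pred (m ∸ n) ⟩
  1-q^ (suc (m ∸ n)) ⊙ 1/poch (suc (m ∸ n))
    ≡⟨ cong (λ k → 1-q^ k ⊙ 1/poch k) (ℕP.+-∸-assoc 1 n≤m) ⟨
  1-q^ (suc m ∸ n) ⊙ 1/poch (suc m ∸ n)        ≈⟨ ⊙-congˡ (1/poch[-]-≤ n≤1+m) ⟨
  1-q^ (suc m ∸ n) ⊙ 1/poch[ suc m - n ]       ∎
  where
  open ≐-Reasoning
  n≤m = ℕP.≤-pred n<1+m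
... | inj₂ refl = begin
  1/poch[ m - suc m ]                              ≈⟨ 1/poch[-]-> {m} ℕP.≤-refl ⟩
  𝟘                                                ≈⟨ ⊙-zeroˡ 1/poch[ suc m - suc m ] ⟨
  𝟘 ⊙ 1/poch[ suc m - suc m ]                      ≈⟨ ⊙-congʳ 1-q^-zero ⟨
  1-q^ 0 ⊙ 1/poch[ suc m - suc m ]
    ≡⟨ cong (λ k → 1-q^ k ⊙ 1/poch[ suc m - suc m ]) (ℕP.n∸n≡0 m) ⟨
  1-q^ (suc m ∸ suc m) ⊙ 1/poch[ suc m - suc m ]   ∎
  where open ≐-Reasoning

-- Lambert series

multiples-summable : ∀ k .{{_ : NonZero k}} → Summable (λ j → q^ (j * k))
multiples-summable k j = vanishesBelow-mono (ℕP.m≤m*n j k) (q^-vanishesBelow (j * k))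

geometric-telescope : ∀ k .{{_ : NonZero k}} → 1-q^ k ⊙ ∑≥1 (λ j → q^ (j * k)) ≐ q^ k
geometric-telescope k = begin
  1-q^ k ⊙ ∑≥1 G                      ≈⟨ ∑≥1-⊙ˡ (1-q^ k) (multiples-summable k) ⟩
  ∑≥1 (λ j → 1-q^ k ⊙ G j)            ≈⟨ ∑≥1-cong (λ j → difference j) ⟩
  ∑≥1 (λ j → G j ⊕ neg (G (suc j)))   ≈⟨ ∑≥1-telescope (multiples-summable k) ⟩
  G 1                                 ≈⟨ q^-cong (ℕP.*-identityˡ k) ⟩
  q^ k                                ∎
  where
  open ≐-Reasoning
  G : ℕ → PS
  G j = q^ (j * k)
  difference : ∀ j → 1-q^ k ⊙ G j ≐ G j ⊕ neg (G (suc j))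
  difference j = ≐-trans (solve 2 (λ x g → (con 1ℤ :- x) :* g := g :- x :* g) ≐-refl (q^ k) (G j))
                         (⊕-congˡ {G j} (neg-cong (q^-+ k (j * k))))

geometric-series : ∀ k .{{_ : NonZero k}} → ∑≥1 (λ j → q^ (j * k)) ≐ q^ k ⊙ 1/[1-q^ k ]
geometric-series k =
  ≐-trans (u⊙f≐g⇒f≐i⊙g (1-q^-inverse k) (geometric-telescope k)) (⊙-comm 1/[1-q^ k ] (q^ k))

weighted-geometric-series : ∀ k .{{_ : NonZero k}} →
  ∑≥1 (λ j → (+ j) · q^ (j * k)) ≐ 1/[1-q^ k ] ⊙ ∑≥1 (λ j → q^ (j * k))
weighted-geometric-series k = u⊙f≐g⇒f≐i⊙g (1-q^-inverse k) (begin
  1-q^ k ⊙ ∑≥1 h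
    ≈⟨ ∑≥1-⊙ˡ (1-q^ k) h-summable ⟩
  ∑≥1 (λ j → 1-q^ k ⊙ h j)
    ≈⟨ ∑≥1-cong (λ j → difference j) ⟩
  ∑≥1 (λ j → h j ⊕ neg (h (suc j)) ⊕ G (suc j))
    ≈⟨ ∑≥1-distrib-⊕ (λ j → h j ⊕ neg (h (suc j))) (G ∘ suc) ⟩
  ∑≥1 (λ j → h j ⊕ neg (h (suc j))) ⊕ ∑≥1 (G ∘ suc)
    ≈⟨ ⊕-cong (∑≥1-telescope h-summable) shift ⟩
  h 1 ⊕ q^ k ⊙ ∑≥1 G
    ≈⟨ ⊕-congʳ h₁ ⟩
  q^ k ⊕ q^ k ⊙ ∑≥1 G
    ≈⟨ ⊕-congʳ (geometric-telescope k) ⟨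
  1-q^ k ⊙ ∑≥1 G ⊕ q^ k ⊙ ∑≥1 G
    ≈⟨ solve 2 (λ x S → (con 1ℤ :- x) :* S :+ x :* S := S) ≐-refl (q^ k) (∑≥1 G) ⟩
  ∑≥1 G
    ∎)
  where
  open ≐-Reasoning
  G h : ℕ → PS
  G j = q^ (j * k)
  h j = (+ j) · G j
  h-summable : Summable h
  h-summable j = ·-vanishesBelow (+ j) (multiples-summable k j)
  h₁ : h 1 ≐ q^ k
  h₁ N = trans (ℤP.*-identityˡ (G 1 N)) (q^-cong (ℕP.*-identityˡ k) N)
  shift : ∑≥1 (G ∘ suc) ≐ q^ k ⊙ ∑≥1 G
  shift = ≐-sym (≐-trans (∑≥1-⊙ˡ (q^ k) (multiples-summable k)) (∑≥1-cong (λ j → q^-+ k (j * k))))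
  difference : ∀ j → 1-q^ k ⊙ h j ≐ h j ⊕ neg (h (suc j)) ⊕ G (suc j)
  difference j = begin
    1-q^ k ⊙ h j                                    ≈⟨ ⊙-congˡ (·≐const⊙ (+ j) (G j)) ⟩
    1-q^ k ⊙ (c ⊙ G j)                              ≈⟨ solve 3 (λ x c g → (con 1ℤ :- x) :* (c :* g)
                                                         := c :* g :- (con 1ℤ :+ c) :* (x :* g) :+ x :* g)
                                                         ≐-refl (q^ k) c (G j) ⟩
    c ⊙ G j ⊕ neg ((𝟙 ⊕ c) ⊙ (q^ k ⊙ G j)) ⊕ q^ k ⊙ G j
      ≈⟨ ⊕-cong (⊕-cong (≐-sym (·≐const⊙ (+ j) (G j))) (neg-cong h-suc)) (q^-+ k (j * k)) ⟩
    h j ⊕ neg (h (suc j)) ⊕ G (suc j)               ∎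
    where
    c = const (+ j)
    h-suc : (𝟙 ⊕ c) ⊙ (q^ k ⊙ G j) ≐ h (suc j)
    h-suc = ≐-sym (begin
      h (suc j)                          ≈⟨ ·≐const⊙ (+ suc j) (G (suc j)) ⟩
      const (+ suc j) ⊙ G (suc j)        ≈⟨ ⊙-cong (_-Raw-AlmostCommutative⟶_.+-homo const-morphism 1ℤ (+ j))
                                                   (≐-sym (q^-+ k (j * k))) ⟩
      (𝟙 ⊕ c) ⊙ (q^ k ⊙ G j)             ∎)

lambertTerm : ℕ → PS
lambertTerm n = q^ n ⊙ 1/[1-q^ n ] ⊙ 1/[1-q^ n ]

lambertSeries : PS
lambertSeries = ∑≥1 (λ n → (+ n) · (q^ n ⊙ 1/[1-q^ n ]))

lambert-identity : ∑≥1 lambertTerm ≐ lambertSeries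
lambert-identity = begin
  ∑≥1 lambertTerm                               ≈⟨ ∑≥1-cong (λ n → as-weighted n) ⟩
  ∑≥1 (λ n → ∑≥1 (λ j → (+ j) · q^ (j * n)))    ≈⟨ ∑≥1-swap (λ n j → (+ j) · q^ (j * n)) ⟩
  ∑≥1 (λ j → ∑≥1 (λ n → (+ j) · q^ (j * n)))    ≈⟨ ∑≥1-cong (λ j → as-geometric j) ⟩
  lambertSeries                                 ∎
  where
  open ≐-Reasoning
  as-weighted : ∀ n .{{_ : NonZero n}} → lambertTerm n ≐ ∑≥1 (λ j → (+ j) · q^ (j * n))
  as-weighted n = ≐-sym (begin
    ∑≥1 (λ j → (+ j) · q^ (j * n))        ≈⟨ weighted-geometric-series n ⟩
    i ⊙ ∑≥1 (λ j → q^ (j * n))            ≈⟨ ⊙-congˡ (geometric-series n) ⟩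
    i ⊙ (q^ n ⊙ i)                        ≈⟨ solve 2 (λ x i → i :* (x :* i) := x :* i :* i)
                                                    ≐-refl (q^ n) i ⟩
    lambertTerm n                         ∎)
    where i = 1/[1-q^ n ]
  as-geometric : ∀ j .{{_ : NonZero j}} →
    ∑≥1 (λ n → (+ j) · q^ (j * n)) ≐ (+ j) · (q^ j ⊙ 1/[1-q^ j ])
  as-geometric j = begin
    ∑≥1 (λ n → (+ j) · q^ (j * n))        ≈⟨ ∑≥1-cong (λ n → ·-cong (+ j) (q^-cong (ℕP.*-comm j n))) ⟩
    ∑≥1 (λ n → (+ j) · q^ (n * j))        ≈⟨ ∑≥1-· (+ j) (λ n → q^ (n * j)) ⟩
    (+ j) · ∑≥1 (λ n → q^ (n * j))        ≈⟨ ·-cong (+ j) (geometric-series j) ⟩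
    (+ j) · (q^ j ⊙ 1/[1-q^ j ])          ∎

-- The left-hand side

lhsTerm : ℕ → ℕ → PS
lhsTerm M n = q^ (n * M + n) ⊙ 1/[1-q^ n ] ⊙ 1/[1-q^ n ] ⊙ ∏₁ M (λ j → 1/[1-q^ (n + j) ])

lhs : ℕ → PS
lhs M = ∑≥1 (lhsTerm M)

lhsAntidifference : ℕ → ℕ → PS
lhsAntidifference M n = q^ (n * suc M) ⊙ 1/[1-q^ n ] ⊙ ∏₁ M (λ j → 1/[1-q^ (n + j) ])

lhsTerm-summable : ∀ M → Summable (lhsTerm M)
lhsTerm-summable M n = ⊙-vanishesBelowˡ _ (⊙-vanishesBelowˡ _ (⊙-vanishesBelowˡ _
  (vanishesBelow-mono (ℕP.m≤n+m n (n * M)) (q^-vanishesBelow _))))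

lhsAntidifference-summable : ∀ M → Summable (lhsAntidifference M)
lhsAntidifference-summable M n =
  ⊙-vanishesBelowˡ _ (⊙-vanishesBelowˡ _ (vanishesBelow-mono (ℕP.m≤m*n n (suc M)) (q^-vanishesBelow _)))

lhsTerm-step-algebra : ∀ {a b x y Π d} →
  (𝟙 ⊕ neg x) ⊙ b ≐ 𝟙 → (𝟙 ⊕ neg (x ⊙ y)) ⊙ d ≐ 𝟙 →
  (𝟙 ⊕ neg y) ⊙ (a ⊙ b ⊙ b ⊙ Π)
    ≐ (𝟙 ⊕ neg y) ⊙ (𝟙 ⊕ neg y) ⊙ (a ⊙ x ⊙ b ⊙ b ⊙ (Π ⊙ d))
      ⊕ (a ⊙ b ⊙ Π ⊕ neg (y ⊙ a ⊙ (Π ⊙ d)))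
lhsTerm-step-algebra {a} {b} {x} {y} {Π} {d} U≐𝟙 V≐𝟙 = ≐-by-units U≐𝟙 V≐𝟙
  (solve 6 (λ a b x y Π d →
     (con 1ℤ :- y) :* (a :* b :* b :* Π)
       :- ((con 1ℤ :- y) :* (con 1ℤ :- y) :* (a :* x :* b :* b :* (Π :* d))
           :+ (a :* b :* Π :- y :* a :* (Π :* d)))
     := a :* Π :* d :* ((con 1ℤ :- y) :* b :- y) :* ((con 1ℤ :- x) :* b :- con 1ℤ)
        :+ a :* Π :* b :* (con 1ℤ :- (con 1ℤ :- y) :* b) :* ((con 1ℤ :- x :* y) :* d :- con 1ℤ))
   ≐-refl a b x y Π d)

lhsTerm-step : ∀ M n .{{_ : NonZero n}} →
  1-q^ (suc M) ⊙ lhsTerm M n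
    ≐ 1-q^ (suc M) ⊙ 1-q^ (suc M) ⊙ lhsTerm (suc M) n
      ⊕ (lhsAntidifference M n ⊕ neg (lhsAntidifference M (suc n)))
lhsTerm-step M n = begin
  u ⊙ lhsTerm M n
    ≈⟨ ⊙-congˡ (⊙-congʳ (⊙-congʳ (⊙-congʳ (q^-cong (trans (ℕP.+-comm (n * M) n)
                                                            (sym (ℕP.*-suc n M))))))) ⟩
  u ⊙ (a ⊙ b ⊙ b ⊙ Π)
    ≈⟨ lhsTerm-step-algebra (1-q^-inverse n)
         (≐-trans (⊙-congʳ {d} (⊕-congˡ {𝟙} (neg-cong (q^-+ n (suc M))))) (1-q^-inverse (n + suc M))) ⟩
  u ⊙ u ⊙ (a ⊙ x ⊙ b ⊙ b ⊙ (Π ⊙ d)) ⊕ (a ⊙ b ⊙ Π ⊕ neg (y ⊙ a ⊙ (Π ⊙ d)))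
    ≈⟨ ⊕-cong (⊙-congˡ (⊙-cong (⊙-congʳ (⊙-congʳ (≐-sym (q^-+ (n * suc M) n)))) (∏₁-suc M I)))
              (⊕-congˡ {a ⊙ b ⊙ Π} (neg-cong next)) ⟨
  u ⊙ u ⊙ lhsTerm (suc M) n ⊕ (lhsAntidifference M n ⊕ neg (lhsAntidifference M (suc n)))
    ∎
  where
  open ≐-Reasoning
  instance
    n+1+M-nonZero : NonZero (n + suc M)
    n+1+M-nonZero = ℕ.>-nonZero (ℕP.<-≤-trans (ℕ.>-nonZero⁻¹ n) (ℕP.m≤m+n n (suc M)))
  u = 1-q^ (suc M)
  I : ℕ → PS
  I j = 1/[1-q^ (n + j) ]
  a = q^ (n * suc M)
  b = 1/[1-q^ n ]
  x = q^ n
  y = q^ (suc M)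
  Π = ∏₁ M I
  d = I (suc M)
  next : lhsAntidifference M (suc n) ≐ y ⊙ a ⊙ (Π ⊙ d)
  next = begin
    q^ (suc M + n * suc M) ⊙ 1/[1-q^ suc n ] ⊙ ∏₁ M (λ j → 1/[1-q^ (suc n + j) ])
      ≈⟨ ⊙-assoc _ _ _ ⟩
    q^ (suc M + n * suc M) ⊙ (1/[1-q^ suc n ] ⊙ ∏₁ M (λ j → 1/[1-q^ (suc n + j) ]))
      ≈⟨ ⊙-cong (≐-sym (q^-+ (suc M) (n * suc M)))
                (≐-sym (≐-trans (∏₁-head M I)
                   (⊙-cong (λ N → cong (λ k → 1/[1-q^ k ] N) (ℕP.+-comm n 1))
                           (∏₁-cong M (λ j N → cong (λ k → 1/[1-q^ k ] N) (ℕP.+-suc n j)))))) ⟩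
    y ⊙ a ⊙ ∏₁ (suc M) I
      ≈⟨ ⊙-congˡ (∏₁-suc M I) ⟩
    y ⊙ a ⊙ (Π ⊙ d) ∎

lhs-recursion : ∀ M → lhs M ≐ 1-q^ (suc M) ⊙ lhs (suc M) ⊕ 1/poch M ⊙ lambertTerm (suc M)
lhs-recursion M = u⊙f≐u⊙g⇒f≐g (1-q^-inverse (suc M)) (begin
  u ⊙ lhs M
    ≈⟨ ∑≥1-⊙ˡ u (lhsTerm-summable M) ⟩
  ∑≥1 (λ n → u ⊙ lhsTerm M n)
    ≈⟨ ∑≥1-cong (λ n → lhsTerm-step M n) ⟩
  ∑≥1 (λ n → u ⊙ u ⊙ lhsTerm (suc M) n ⊕ (A n ⊕ neg (A (suc n))))
    ≈⟨ ∑≥1-distrib-⊕ (λ n → u ⊙ u ⊙ lhsTerm (suc M) n) (λ n → A n ⊕ neg (A (suc n))) ⟩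
  ∑≥1 (λ n → u ⊙ u ⊙ lhsTerm (suc M) n) ⊕ ∑≥1 (λ n → A n ⊕ neg (A (suc n)))
    ≈⟨ ⊕-cong (≐-sym (∑≥1-⊙ˡ (u ⊙ u) (lhsTerm-summable (suc M))))
              (∑≥1-telescope (lhsAntidifference-summable M)) ⟩
  u ⊙ u ⊙ lhs (suc M) ⊕ A 1
    ≈⟨ ⊕-congˡ {u ⊙ u ⊙ lhs (suc M)} A₁ ⟩
  u ⊙ u ⊙ lhs (suc M) ⊕ q^ (suc M) ⊙ (1/poch M ⊙ i)
    ≈⟨ ≐-by-unit (1-q^-inverse (suc M))
         (solve 5 (λ u X y I i → u :* u :* X :+ y :* (I :* i) :- u :* (u :* X :+ I :* (y :* i :* i))
                                := :- (y :* I :* i) :* (u :* i :- con 1ℤ))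
           ≐-refl u (lhs (suc M)) (q^ (suc M)) (1/poch M) i) ⟩
  u ⊙ (u ⊙ lhs (suc M) ⊕ 1/poch M ⊙ lambertTerm (suc M))
    ∎)
  where
  open ≐-Reasoning
  u = 1-q^ (suc M)
  i = 1/[1-q^ suc M ]
  A = lhsAntidifference M
  A₁ : A 1 ≐ q^ (suc M) ⊙ (1/poch M ⊙ i)
  A₁ = begin
    q^ (1 * suc M) ⊙ 1/[1-q^ 1 ] ⊙ ∏₁ M (λ j → 1/[1-q^ suc j ])
      ≈⟨ ⊙-assoc _ _ _ ⟩
    q^ (1 * suc M) ⊙ (1/[1-q^ 1 ] ⊙ ∏₁ M (λ j → 1/[1-q^ suc j ]))
      ≈⟨ ⊙-cong (q^-cong (ℕP.*-identityˡ (suc M))) (≐-sym (∏₁-head M 1/[1-q^_])) ⟩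
    q^ (suc M) ⊙ 1/poch (suc M)
      ≈⟨ ⊙-congˡ (∏₁-suc M 1/[1-q^_]) ⟩
    q^ (suc M) ⊙ (1/poch M ⊙ i) ∎

poch-lhs-recursion : ∀ M → poch M ⊙ lhs M ≐ poch (suc M) ⊙ lhs (suc M) ⊕ lambertTerm (suc M)
poch-lhs-recursion M = begin
  poch M ⊙ lhs M
    ≈⟨ ⊙-congˡ (lhs-recursion M) ⟩
  poch M ⊙ (1-q^ (suc M) ⊙ lhs (suc M) ⊕ 1/poch M ⊙ lambertTerm (suc M))
    ≈⟨ solve 5 (λ P u X I c → P :* (u :* X :+ I :* c) := P :* u :* X :+ P :* I :* c)
         ≐-refl (poch M) (1-q^ (suc M)) (lhs (suc M)) (1/poch M) (lambertTerm (suc M)) ⟩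
  poch M ⊙ 1-q^ (suc M) ⊙ lhs (suc M) ⊕ poch M ⊙ 1/poch M ⊙ lambertTerm (suc M)
    ≈⟨ ⊕-cong (⊙-congʳ (≐-sym (∏₁-suc M 1-q^))) (⊙-congʳ (poch-inverse M)) ⟩
  poch (suc M) ⊙ lhs (suc M) ⊕ 𝟙 ⊙ lambertTerm (suc M)
    ≈⟨ ⊕-congˡ {poch (suc M) ⊙ lhs (suc M)} (⊙-identityˡ (lambertTerm (suc M))) ⟩
  poch (suc M) ⊙ lhs (suc M) ⊕ lambertTerm (suc M)
    ∎
  where open ≐-Reasoning

lhsTerm-zero : ∀ n → lhsTerm 0 n ≐ lambertTerm n
lhsTerm-zero n = ≐-trans (⊙-identityʳ (q^ (n * 0 + n) ⊙ i ⊙ i))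
                         (⊙-congʳ (⊙-congʳ (q^-cong (cong (_+ n) (ℕP.*-zeroʳ n)))))
  where i = 1/[1-q^ n ]

poch-lhs : ∀ M → ∑≥1 lambertTerm ≐ poch M ⊙ lhs M ⊕ ∑≤ M lambertTerm
poch-lhs M = begin
  ∑≥1 lambertTerm
    ≈⟨ ∑≥1-cong (λ n → lhsTerm-zero n) ⟨
  lhs 0
    ≈⟨ ⊙-identityˡ (lhs 0) ⟨
  poch 0 ⊙ lhs 0
    ≈⟨ ∑≤-telescope (λ m → poch m ⊙ lhs m) lambertTerm poch-lhs-recursion M ⟩
  poch M ⊙ lhs M ⊕ ∑≤ M lambertTerm
    ∎
  where open ≐-Reasoning

-- The right-hand side

triangular : ℕ → ℕ
triangular n = n * suc n / 2

triangular-suc : ∀ n → triangular (suc n) ≡ triangular n + suc n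
triangular-suc n = begin
  suc n * suc (suc n) / 2          ≡⟨ cong (_/ 2) (ℕ-solve 1 (λ n → (ℕ-con 1 ℕ:+ n) ℕ:* (ℕ-con 2 ℕ:+ n)
                                        ℕ:= n ℕ:* (ℕ-con 1 ℕ:+ n) ℕ:+ (ℕ-con 1 ℕ:+ n) ℕ:* ℕ-con 2) refl n) ⟩
  (n * suc n + suc n * 2) / 2      ≡⟨ +-distrib-/-∣ʳ (n * suc n) (n∣m*n (suc n)) ⟩
  triangular n + suc n * 2 / 2     ≡⟨ cong (λ k → triangular n + k) (m*n/n≡m (suc n) 2) ⟩
  triangular n + suc n             ∎
  where
  open ≡-Reasoning
  open ℕ-Solver.+-*-Solver using ()
    renaming (solve to ℕ-solve; _:=_ to _ℕ:=_; _:+_ to _ℕ:+_; _:*_ to _ℕ:*_; con to ℕ-con)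

n≤triangular : ∀ n → n ≤ triangular n
n≤triangular zero    = z≤n
n≤triangular (suc n) = subst (suc n ≤_) (sym (triangular-suc n)) (ℕP.m≤n+m (suc n) (triangular n))

q^-triangular-suc : ∀ n → q^ (triangular (suc n)) ≐ q^ (triangular n) ⊙ q^ (suc n)
q^-triangular-suc n = ≐-trans (q^-cong (triangular-suc n)) (≐-sym (q^-+ (triangular n) (suc n)))

sign : ℕ → PS
sign n = const ((- 1ℤ) ^ n)

sign-suc : ∀ n → sign (suc n) ≐ neg (sign n)
sign-suc n = ≐-trans (_-Raw-AlmostCommutative⟶_.*-homo const-morphism (- 1ℤ) ((- 1ℤ) ^ n))
                     (solve 1 (λ s → con (- 1ℤ) :* s := :- s) ≐-refl (sign n))

rhsFactor : ℕ → ℕ → PS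
rhsFactor M n =
  q^ (triangular n) ⊙ (𝟙 ⊕ q^ n) ⊙ 1/poch[ M - n ] ⊙ 1/poch (M + n) ⊙ 1/[1-q^ n ] ⊙ 1/[1-q^ n ]

rhsTerm : ℕ → ℕ → PS
rhsTerm M n = sign n ⊙ rhsFactor M n

rhs : ℕ → PS
rhs M = ∑≥1 (rhsTerm M)

rhsTerm-summable : ∀ M → Summable (rhsTerm M)
rhsTerm-summable M n = ⊙-vanishesBelowʳ _ (⊙-vanishesBelowˡ _ (⊙-vanishesBelowˡ _ (⊙-vanishesBelowˡ _
  (⊙-vanishesBelowˡ _ (⊙-vanishesBelowˡ _ (vanishesBelow-mono (n≤triangular n) (q^-vanishesBelow _)))))))

rhsTerm-vanishes : ∀ {M n} → M < n → rhsTerm M n ≐ 𝟘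
rhsTerm-vanishes {M} {n} M<n = begin
  rhsTerm M n
    ≈⟨ ⊙-congˡ (⊙-congʳ (⊙-congʳ (⊙-congʳ (⊙-congˡ (1/poch[-]-> M<n))))) ⟩
  sign n ⊙ (q^ (triangular n) ⊙ (𝟙 ⊕ q^ n) ⊙ 𝟘 ⊙ 1/poch (M + n) ⊙ i ⊙ i)
    ≈⟨ solve 6 (λ s t u B i j → s :* (t :* u :* con 0ℤ :* B :* i :* j) := con 0ℤ)
         ≐-refl (sign n) (q^ (triangular n)) (𝟙 ⊕ q^ n) (1/poch (M + n)) i i ⟩
  𝟘 ∎
  where
  open ≐-Reasoning
  i = 1/[1-q^ n ]

clearedRhsTerm : ℕ → ℕ → PS
clearedRhsTerm M n = poch M ⊙ poch M ⊙ rhsTerm M n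

clearedRhsTerm-factor : ∀ K n {P s t L B} →
  poch K ≐ P → sign n ≐ s → q^ (triangular n) ≐ t → 1/poch[ K - n ] ≐ L → 1/poch (K + n) ≐ B →
  clearedRhsTerm K n ≐ P ⊙ P ⊙ (s ⊙ (t ⊙ (𝟙 ⊕ q^ n) ⊙ L ⊙ B ⊙ 1/[1-q^ n ] ⊙ 1/[1-q^ n ]))
clearedRhsTerm-factor K n P≐ s≐ t≐ L≐ B≐ =
  ⊙-cong (⊙-cong P≐ P≐) (⊙-cong s≐ (⊙-congʳ (⊙-congʳ (⊙-cong (⊙-cong (⊙-congʳ t≐) L≐) B≐))))

rhsAntidifference : ℕ → ℕ → PS
rhsAntidifference M j = sign j ⊙ (q^ (triangular j) ⊙ 1/[1-q^ suc M ] ⊙ poch (suc M) ⊙ poch (suc M)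
                                  ⊙ 1/poch[ M - j ] ⊙ 1/poch (suc M + j))

rhsAntidifference-factor : ∀ M j {P s t L B} → poch (suc M) ≐ P → sign j ≐ s →
  q^ (triangular j) ≐ t → 1/poch[ M - j ] ≐ L → 1/poch (suc M + j) ≐ B →
  rhsAntidifference M j ≐ s ⊙ (t ⊙ 1/[1-q^ suc M ] ⊙ P ⊙ P ⊙ L ⊙ B)
rhsAntidifference-factor M j P≐ s≐ t≐ L≐ B≐ =
  ⊙-cong s≐ (⊙-cong (⊙-cong (⊙-cong (⊙-cong (⊙-congʳ t≐) P≐) P≐) L≐) B≐)

rhsTerm-step-algebra : ∀ {s t x y P L B b d} →
  (𝟙 ⊕ neg x) ⊙ b ≐ 𝟙 → (𝟙 ⊕ neg (x ⊙ y)) ⊙ d ≐ 𝟙 →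
  let e = 𝟙 ⊕ neg (x ⊙ y); z = 𝟙 ⊕ neg y; w = 𝟙 ⊕ neg (x ⊙ x ⊙ y) in
  P ⊙ P ⊙ (neg s ⊙ (t ⊙ x ⊙ (𝟙 ⊕ x) ⊙ (z ⊙ L) ⊙ (w ⊙ B) ⊙ b ⊙ b))
    ≐ P ⊙ e ⊙ (P ⊙ e) ⊙ (neg s ⊙ (t ⊙ x ⊙ (𝟙 ⊕ x) ⊙ L ⊙ B ⊙ b ⊙ b))
      ⊕ x ⊙ y ⊙ d ⊙ d ⊙ (s ⊙ (t ⊙ d ⊙ (P ⊙ e) ⊙ (P ⊙ e) ⊙ L ⊙ (w ⊙ B))
                         ⊕ neg (neg s ⊙ (t ⊙ x ⊙ d ⊙ (P ⊙ e) ⊙ (P ⊙ e) ⊙ (z ⊙ L) ⊙ B)))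
rhsTerm-step-algebra {s} {t} {x} {y} {P} {L} {B} {b} {d} U≐𝟙 V≐𝟙 = ≐-by-units U≐𝟙 V≐𝟙
  (solve 9 (λ s t x y P L B b d →
     let e = con 1ℤ :- x :* y; z = con 1ℤ :- y; w = con 1ℤ :- x :* x :* y
         U = (con 1ℤ :- x) :* b; V = e :* d
         K = :- s :* t :* x :* (con 1ℤ :+ x) :* P :* P :* L :* B in
     P :* P :* (:- s :* (t :* x :* (con 1ℤ :+ x) :* (z :* L) :* (w :* B) :* b :* b))
       :- (P :* e :* (P :* e) :* (:- s :* (t :* x :* (con 1ℤ :+ x) :* L :* B :* b :* b))
           :+ x :* y :* d :* d :* (s :* (t :* d :* (P :* e) :* (P :* e) :* L :* (w :* B))
                                   :- :- s :* (t :* x :* d :* (P :* e) :* (P :* e) :* (z :* L) :* B)))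
     := :- (K :* y :* (U :+ con 1ℤ)) :* (U :- con 1ℤ) :+ K :* y :* (V :* V :+ V :+ con 1ℤ) :* (V :- con 1ℤ))
   ≐-refl s t x y P L B b d)

clearedRhsTerm-step : ∀ M j → j ≤ M →
  clearedRhsTerm M (suc j)
    ≐ clearedRhsTerm (suc M) (suc j)
      ⊕ lambertTerm (suc M) ⊙ (rhsAntidifference M j ⊕ neg (rhsAntidifference M (suc j)))
clearedRhsTerm-step M j j≤M = begin
  clearedRhsTerm M n
    ≈⟨ clearedRhsTerm-factor M n ≐-refl (sign-suc j) (q^-triangular-suc j) (1/poch[-]-pred M n n≤N) B-M ⟩
  P ⊙ P ⊙ (neg s ⊙ (t ⊙ x ⊙ (𝟙 ⊕ x) ⊙ (z ⊙ L) ⊙ (w ⊙ B) ⊙ b ⊙ b))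
    ≈⟨ rhsTerm-step-algebra (1-q^-inverse n) V≐𝟙 ⟩
  P ⊙ e ⊙ (P ⊙ e) ⊙ (neg s ⊙ (t ⊙ x ⊙ (𝟙 ⊕ x) ⊙ L ⊙ B ⊙ b ⊙ b))
    ⊕ x ⊙ y ⊙ d ⊙ d ⊙ (s ⊙ (t ⊙ d ⊙ (P ⊙ e) ⊙ (P ⊙ e) ⊙ L ⊙ (w ⊙ B))
                       ⊕ neg (neg s ⊙ (t ⊙ x ⊙ d ⊙ (P ⊙ e) ⊙ (P ⊙ e) ⊙ (z ⊙ L) ⊙ B)))
    ≈⟨ ⊕-cong (clearedRhsTerm-factor N n P-N (sign-suc j) (q^-triangular-suc j) ≐-refl ≐-refl)
              (⊙-cong (⊙-congʳ (⊙-congʳ (q^-split n≤N)))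
                      (⊕-cong (rhsAntidifference-factor M j P-N ≐-refl ≐-refl (≐-sym (1/poch[-]-suc M j)) B-j)
                              (neg-cong (rhsAntidifference-factor M n P-N (sign-suc j) (q^-triangular-suc j)
                                                                  (1/poch[-]-pred M n n≤N) ≐-refl)))) ⟨
  clearedRhsTerm N n ⊕ lambertTerm N ⊙ (rhsAntidifference M j ⊕ neg (rhsAntidifference M n))
    ∎
  where
  open ≐-Reasoning
  N = suc M
  n = suc j
  n≤N : n ≤ N
  n≤N = s≤s j≤M
  s = sign j
  t = q^ (triangular j)
  x = q^ n
  y = q^ (N ∸ n)
  P = poch M
  L = 1/poch[ N - n ]
  B = 1/poch (N + n)
  b = 1/[1-q^ n ]
  d = 1/[1-q^ N ]
  e = 𝟙 ⊕ neg (x ⊙ y)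
  z = 𝟙 ⊕ neg y
  w = 𝟙 ⊕ neg (x ⊙ x ⊙ y)
  q^N : q^ N ≐ x ⊙ y
  q^N = q^-split n≤N
  q^N+n : q^ (N + n) ≐ x ⊙ x ⊙ y
  q^N+n = begin
    q^ (N + n)      ≡⟨ cong q^ (ℕP.+-comm N n) ⟩
    q^ (n + N)      ≈⟨ q^-+ n N ⟨
    x ⊙ q^ N        ≈⟨ ⊙-congˡ q^N ⟩
    x ⊙ (x ⊙ y)     ≈⟨ ⊙-assoc x x y ⟨
    x ⊙ x ⊙ y       ∎
  V≐𝟙 : e ⊙ d ≐ 𝟙
  V≐𝟙 = ≐-trans (⊙-congʳ (⊕-congˡ {𝟙} (neg-cong (≐-sym q^N)))) (1-q^-inverse N)
  P-N : poch N ≐ P ⊙ e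
  P-N = ≐-trans (∏₁-suc M 1-q^) (⊙-congˡ (⊕-congˡ {𝟙} (neg-cong q^N)))
  B-M : 1/poch (M + n) ≐ w ⊙ B
  B-M = ≐-trans (1/poch-pred (M + n)) (⊙-congʳ (⊕-congˡ {𝟙} (neg-cong q^N+n)))
  B-j : 1/poch (N + j) ≐ w ⊙ B
  B-j = ≐-trans (λ k → cong (λ m → 1/poch m k) (sym (ℕP.+-suc M j))) B-M

rhsAntidifference-zero : ∀ M → rhsAntidifference M 0 ≐ 𝟙
rhsAntidifference-zero M = begin
  𝟙 ⊙ (q^ 0 ⊙ i ⊙ poch N ⊙ poch N ⊙ 1/poch[ M - 0 ] ⊙ 1/poch (N + 0))
    ≈⟨ ⊙-congˡ (⊙-cong (⊙-cong (⊙-cong (⊙-cong (⊙-congʳ q^-zero) P-N) P-N)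
                               (1/poch[-]-≤ {M} z≤n))
                       (λ k → cong (λ m → 1/poch m k) (ℕP.+-identityʳ N))) ⟩
  𝟙 ⊙ (𝟙 ⊙ i ⊙ (P ⊙ u) ⊙ (P ⊙ u) ⊙ 1/poch M ⊙ 1/poch N)
    ≈⟨ solve 5 (λ i P u I I′ → con 1ℤ :* (con 1ℤ :* i :* (P :* u) :* (P :* u) :* I :* I′)
                             := u :* i :* (P :* I) :* (P :* u :* I′))
         ≐-refl i P u (1/poch M) (1/poch N) ⟩
  u ⊙ i ⊙ (P ⊙ 1/poch M) ⊙ (P ⊙ u ⊙ 1/poch N)
    ≈⟨ ⊙-cong (⊙-cong (1-q^-inverse N) (poch-inverse M))
              (≐-trans (⊙-congʳ (≐-sym P-N)) (poch-inverse N)) ⟩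
  𝟙 ⊙ 𝟙 ⊙ 𝟙
    ≈⟨ solve 0 (con 1ℤ :* con 1ℤ :* con 1ℤ := con 1ℤ) ≐-refl ⟩
  𝟙 ∎
  where
  open ≐-Reasoning
  N = suc M
  P = poch M
  u = 1-q^ N
  i = 1/[1-q^ N ]
  P-N : poch N ≐ P ⊙ u
  P-N = ∏₁-suc M 1-q^

rhsAntidifference-top : ∀ M → rhsAntidifference M (suc M) ≐ 𝟘
rhsAntidifference-top M = begin
  rhsAntidifference M (suc M)
    ≈⟨ ⊙-congˡ (⊙-congʳ (⊙-congˡ (1/poch[-]-> {M} ℕP.≤-refl))) ⟩
  sign (suc M) ⊙ (q^ (triangular (suc M)) ⊙ i ⊙ poch (suc M) ⊙ poch (suc M) ⊙ 𝟘
                  ⊙ 1/poch (suc M + suc M))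
    ≈⟨ solve 5 (λ s t i P B → s :* (t :* i :* P :* P :* con 0ℤ :* B) := con 0ℤ)
         ≐-refl (sign (suc M)) (q^ (triangular (suc M))) i (poch (suc M)) (1/poch (suc M + suc M)) ⟩
  𝟘 ∎
  where
  open ≐-Reasoning
  i = 1/[1-q^ suc M ]

rhsAntidifference-telescope : ∀ M →
  ∑≤ (suc M) (λ n → rhsAntidifference M (pred n) ⊕ neg (rhsAntidifference M n)) ≐ 𝟙
rhsAntidifference-telescope M = begin
  ∑≤ N D                    ≈⟨ ⊕-identityˡ (∑≤ N D) ⟨
  𝟘 ⊕ ∑≤ N D                ≈⟨ ⊕-congʳ (rhsAntidifference-top M) ⟨
  G N ⊕ ∑≤ N D              ≈⟨ ∑≤-telescope G D difference N ⟨
  G 0                       ≈⟨ rhsAntidifference-zero M ⟩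
  𝟙                         ∎
  where
  open ≐-Reasoning
  N = suc M
  G = rhsAntidifference M
  D : ℕ → PS
  D n = G (pred n) ⊕ neg (G n)
  difference : ∀ m → G m ≐ G (suc m) ⊕ D (suc m)
  difference m = solve 2 (λ a b → a := b :+ (a :- b)) ≐-refl (G m) (G (suc m))

clearedRhsSum-recursion : ∀ M →
  ∑≤ M (clearedRhsTerm M) ≐ ∑≤ (suc M) (clearedRhsTerm (suc M)) ⊕ lambertTerm (suc M)
clearedRhsSum-recursion M = begin
  ∑≤ M (clearedRhsTerm M)
    ≈⟨ ⊕-identityʳ _ ⟨
  ∑≤ M (clearedRhsTerm M) ⊕ 𝟘
    ≈⟨ ⊕-congˡ {∑≤ M (clearedRhsTerm M)}
         (≐-trans (⊙-congˡ (rhsTerm-vanishes {M} ℕP.≤-refl)) (⊙-zeroʳ (poch M ⊙ poch M))) ⟨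
  ∑≤ N (clearedRhsTerm M)
    ≈⟨ ∑≤-cong N {clearedRhsTerm M} {λ n → clearedRhsTerm N n ⊕ c ⊙ D n}
         (λ { (suc j) (s≤s j≤M) → clearedRhsTerm-step M j j≤M }) ⟩
  ∑≤ N (λ n → clearedRhsTerm N n ⊕ c ⊙ D n)
    ≈⟨ ∑≤-distrib-⊕ N (clearedRhsTerm N) (λ n → c ⊙ D n) ⟩
  ∑≤ N (clearedRhsTerm N) ⊕ ∑≤ N (λ n → c ⊙ D n)
    ≈⟨ ⊕-congˡ {∑≤ N (clearedRhsTerm N)} (∑≤-⊙ˡ c N D) ⟨
  ∑≤ N (clearedRhsTerm N) ⊕ c ⊙ ∑≤ N D
    ≈⟨ ⊕-congˡ {∑≤ N (clearedRhsTerm N)}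
         (≐-trans (⊙-congˡ (rhsAntidifference-telescope M)) (⊙-identityʳ c)) ⟩
  ∑≤ N (clearedRhsTerm N) ⊕ c
    ∎
  where
  open ≐-Reasoning
  N = suc M
  c = lambertTerm N
  D : ℕ → PS
  D n = rhsAntidifference M (pred n) ⊕ neg (rhsAntidifference M n)

poch²-rhs : ∀ M → poch M ⊙ poch M ⊙ rhs M ≐ ∑≤ M (clearedRhsTerm M)
poch²-rhs M = ≐-trans (⊙-congˡ (∑≥1-truncate M (rhsTerm-summable M) (λ n → rhsTerm-vanishes)))
                      (∑≤-⊙ˡ (poch M ⊙ poch M) M (rhsTerm M))

clearedRhsSum-cancels-lambertSum : ∀ M → 𝟘 ≐ ∑≤ M (clearedRhsTerm M) ⊕ ∑≤ M lambertTerm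
clearedRhsSum-cancels-lambertSum =
  ∑≤-telescope (λ m → ∑≤ m (clearedRhsTerm m)) lambertTerm clearedRhsSum-recursion

poch-lhs-expansion : ∀ M → poch M ⊙ lhs M ≐ lambertSeries ⊕ poch M ⊙ poch M ⊙ rhs M
poch-lhs-expansion M = begin
  P ⊙ lhs M
    ≈⟨ solve 3 (λ X H C → X := X :+ H :- (C :+ H) :+ C) ≐-refl (P ⊙ lhs M) H C ⟩
  P ⊙ lhs M ⊕ H ⊕ neg (C ⊕ H) ⊕ C
    ≈⟨ ⊕-cong (⊕-cong (≐-sym (poch-lhs M)) (neg-cong (≐-sym (clearedRhsSum-cancels-lambertSum M))))
              (≐-sym (poch²-rhs M)) ⟩
  ∑≥1 lambertTerm ⊕ neg 𝟘 ⊕ P ⊙ P ⊙ rhs M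
    ≈⟨ ⊕-congʳ (⊕-cong lambert-identity (λ _ → refl)) ⟩
  lambertSeries ⊕ 𝟘 ⊕ P ⊙ P ⊙ rhs M
    ≈⟨ ⊕-congʳ (⊕-identityʳ lambertSeries) ⟩
  lambertSeries ⊕ P ⊙ P ⊙ rhs M
    ∎
  where
  open ≐-Reasoning
  P = poch M
  H = ∑≤ M lambertTerm
  C = ∑≤ M (clearedRhsTerm M)

lhs-expansion : ∀ M → lhs M ≐ 1/poch M ⊙ lambertSeries ⊕ poch M ⊙ rhs M
lhs-expansion M = ≐-trans (u⊙f≐g⇒f≐i⊙g (poch-inverse M) (poch-lhs-expansion M))
  (≐-by-unit (poch-inverse M)
    (solve 4 (λ P I S Z → I :* (S :+ P :* P :* Z) :- (I :* S :+ P :* Z) := P :* Z :* (P :* I :- con 1ℤ))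
      ≐-refl (poch M) (1/poch M) lambertSeries (rhs M)))

opaque
  unfolding _⊙_

  lhs-⊛ : ∀ M →
    ∑≥1 (λ n → q^ (n * M + n) ⊛ 1/[1-q^ n ] ⊛ 1/[1-q^ n ] ⊛ ∏₁ M (λ j → 1/[1-q^ (n + j) ])) ≐ lhs M
  lhs-⊛ M = ≐-refl

  lambertSeries-⊛ : ∑≥1 (λ n → (+ n) · (q^ n ⊛ 1/[1-q^ n ])) ≐ lambertSeries
  lambertSeries-⊛ = ≐-refl

  rhs-⊛ : ∀ M → ∑≥1 (λ n → (- 1ℤ) ^ n · (q^ ((n * suc n) / 2) ⊛ (𝟙 ⊕ q^ n) ⊛ 1/poch[ M - n ] ⊛ 1/poch (M + n)
                                          ⊛ 1/[1-q^ n ] ⊛ 1/[1-q^ n ])) ≐ rhs M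
  rhs-⊛ M = ∑≥1-cong (λ n → ·≐const⊙ ((- 1ℤ) ^ n) (rhsFactor M n))

theorem3p1 : (M : ℕ) →
    ∑≥1 (λ n → q^ (n * M + n) ⊛ 1/[1-q^ n ] ⊛ 1/[1-q^ n ] ⊛ ∏₁ M (λ j → 1/[1-q^ (n + j) ]))
    ≐
    1/poch M ⊛ ∑≥1 (λ n → (+ n) · (q^ n ⊛ 1/[1-q^ n ]))
    ⊕ poch M ⊛ ∑≥1 (λ n → ((- 1ℤ) ^ n) · (q^ ((n * suc n) / 2) ⊛ (𝟙 ⊕ q^ n)
                               ⊛ 1/poch[ M - n ] ⊛ 1/poch (M + n)
                               ⊛ 1/[1-q^ n ] ⊛ 1/[1-q^ n ]))
theorem3p1 M =
  ≐-trans (lhs-⊛ M)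
    (≐-trans (lhs-expansion M)
      (≐-sym (⊕-cong (≐-trans (⊛≐⊙ (1/poch M) _) (⊙-congˡ lambertSeries-⊛))
                     (≐-trans (⊛≐⊙ (poch M) _) (⊙-congˡ (rhs-⊛ M))))))
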